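{- Let $n\ge 2$ and let $Q\subseteq S_n$ be minimally inversion-complete. Then every critical selection graph $G_Q$ corresponding to $Q$ is triangle-free.
   Context: $S_n$ is the set of permutations of $[n]$, written as sequences $(\pi(1),\dots,\pi(n))$; $\pi$ covers the ordered pair $(\pi(k),\pi(l))$ iff $k<l$. An inversion is a pair $(j,i)$ with $1\le i<j\le n$. $Q\subseteq S_n$ is inversion-complete if every inversion is covered by some element of $Q$, and minimally inversion-complete if no proper subset of $Q$ is inversion-complete. For minimally inversion-complete $Q$, an inversion is critical for $\pi\in Q$ if it is covered by $\pi$ and by no other permutation of $Q$ (every $\pi\in Q$ covers at least one critical inversion). A critical selection graph $G_Q=([n],E_Q)$ is obtained by selecting, for each $\pi\in Q$, one critical inversion covered by $\pi$, and letting $E_Q$ be the set of these $|Q|$ selected inversions regarded as undirected edges $\{i,j\}$. -}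

module Defs where

open import Data.Nat using (ℕ)
open import Data.Fin using (Fin; _<_)
open import Data.Fin.Permutation using (Permutation′; _⟨$⟩ʳ_)
open import Data.Fin.Subset using (Subset; _∈_; _∉_)
open import Data.Product using (Σ; ∃; ∃-syntax; _×_; _,_; proj₁; proj₂)
open import Data.Sum using (_⊎_)
open import Relation.Binary.PropositionalEquality using (_≡_; _≢_)
open import Relation.Nullary using (¬_)

-- Elements of [n] are represented by Fin n (0-based; order preserved).
-- A permutation of [n] is a bijection Fin n ↔ Fin n; its sequence is
-- (π ⟨$⟩ʳ 0, …, π ⟨$⟩ʳ (n-1)).

Covers : ∀ {n} → Permutation′ n → Fin n → Fin n → Set
Covers π a b = ∃[ k ] ∃[ l ] (k < l × π ⟨$⟩ʳ k ≡ a × π ⟨$⟩ʳ l ≡ b)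

Inversion : ℕ → Set
Inversion n = Σ (Fin n × Fin n) λ p → proj₂ p < proj₁ p

_≈ₚ_ : ∀ {n} → Permutation′ n → Permutation′ n → Set
π ≈ₚ σ = ∀ k → π ⟨$⟩ʳ k ≡ σ ⟨$⟩ʳ k

-- A finite set Q ⊆ S_n of size m is given by an enumeration Q : Fin m → S_n
-- without repetitions.
NoRepeats : ∀ {m n} → (Fin m → Permutation′ n) → Set
NoRepeats Q = ∀ s t → Q s ≈ₚ Q t → s ≡ t

InversionCompleteOn : ∀ {m n} → (Fin m → Permutation′ n) → Subset m → Set
InversionCompleteOn {n = n} Q S =
  (inv : Inversion n) → ∃[ t ] (t ∈ S × Covers (Q t) (proj₁ (proj₁ inv)) (proj₂ (proj₁ inv)))

InversionComplete : ∀ {m n} → (Fin m → Permutation′ n) → Set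
InversionComplete {n = n} Q =
  (inv : Inversion n) → ∃[ t ] Covers (Q t) (proj₁ (proj₁ inv)) (proj₂ (proj₁ inv))

MinimallyInversionComplete : ∀ {m n} → (Fin m → Permutation′ n) → Set
MinimallyInversionComplete {m} Q =
  InversionComplete Q ×
  ((S : Subset m) → (∃[ t ] t ∉ S) → ¬ InversionCompleteOn Q S)

Critical : ∀ {m n} → (Fin m → Permutation′ n) → Fin m → Inversion n → Set
Critical Q t ((j , i) , _) =
  Covers (Q t) j i × (∀ s → s ≢ t → ¬ Covers (Q s) j i)

CriticalSelection : ∀ {m n} → (Fin m → Permutation′ n) → Set
CriticalSelection {m} {n} Q = Σ (Fin m → Inversion n) λ sel → ∀ t → Critical Q t (sel t)

-- The edge set E_Q of the critical selection graph ([n], E_Q):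
-- {a , b} is an edge iff some selected inversion is (a , b) or (b , a).
Edge : ∀ {m n} {Q : Fin m → Permutation′ n} → CriticalSelection Q → Fin n → Fin n → Set
Edge (sel , _) a b =
  ∃[ t ] ((proj₁ (sel t) ≡ (a , b)) ⊎ (proj₁ (sel t) ≡ (b , a)))

TriangleFree : ∀ {n} → (Fin n → Fin n → Set) → Set
TriangleFree {n} E =
  (a b c : Fin n) → a ≢ b → b ≢ c → a ≢ c → ¬ (E a b × E b c × E a c)

-- Orient each edge of a triangle from its larger to its smaller vertex.  If
-- the orientation is cyclic the vertex order is violated.  Otherwise the
-- triangle is x < y < z with selected inversions (y,x), (z,y), (z,x), and the
-- permutation π selecting (z,x) places z before x.  Since (y,x) and (z,y) are
-- critical for other elements of Q, π covers neither, so it places x before y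
-- and y before z, hence x before z: a contradiction.
module Submission where

open import Defs
open import Data.Nat using (ℕ; _≥_)
open import Data.Fin using (Fin; _<_; _≟_)
open import Data.Fin.Permutation using (Permutation′; _⟨$⟩ʳ_; _⟨$⟩ˡ_; inverseˡ; inverseʳ)
open import Data.Fin.Properties using (<-cmp; <-trans; <-irrefl; <⇒≢)
open import Data.Product using (∃-syntax; _,_; proj₁; proj₂)
open import Data.Sum using (_⊎_; inj₁; inj₂)
open import Data.Empty using (⊥; ⊥-elim)
open import Relation.Binary using (tri<; tri≈; tri>)
open import Relation.Binary.PropositionalEquality
  using (_≡_; _≢_; refl; sym; trans; cong; subst)
open import Relation.Nullary using (¬_; yes; no)

module _ {n : ℕ} (π : Permutation′ n) where

  covers⇒< : ∀ {a b} → Covers π a b → π ⟨$⟩ˡ a < π ⟨$⟩ˡ b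
  covers⇒< (k , l , k<l , refl , refl) =
    subst (_< π ⟨$⟩ˡ (π ⟨$⟩ʳ l)) (sym (inverseˡ π))
      (subst (k <_) (sym (inverseˡ π)) k<l)

  ¬covers⇒> : ∀ {a b} → a ≢ b → ¬ Covers π a b → π ⟨$⟩ˡ b < π ⟨$⟩ˡ a
  ¬covers⇒> {a} {b} a≢b ¬cov with <-cmp (π ⟨$⟩ˡ a) (π ⟨$⟩ˡ b)
  ... | tri< lt _ _ = ⊥-elim (¬cov (π ⟨$⟩ˡ a , π ⟨$⟩ˡ b , lt , inverseʳ π , inverseʳ π))
  ... | tri≈ _ eq _ =
    ⊥-elim (a≢b (trans (sym (inverseʳ π)) (trans (cong (π ⟨$⟩ʳ_) eq) (inverseʳ π))))
  ... | tri> _ _ gt = gt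

module _ {m n : ℕ} (Q : Fin m → Permutation′ n) where

  critical⇒unique-coverer : ∀ {t s} inv → Critical Q t inv →
                            Covers (Q s) (proj₁ (proj₁ inv)) (proj₂ (proj₁ inv)) → s ≡ t
  critical⇒unique-coverer {t} {s} _ (_ , uncovered) cov with s ≟ t
  ... | yes s≡t = s≡t
  ... | no s≢t = ⊥-elim (uncovered s s≢t cov)

module SelectionGraph {m n : ℕ} {Q : Fin m → Permutation′ n} (G : CriticalSelection Q) where

  private
    sel : Fin m → Inversion n
    sel = proj₁ G

    crit : ∀ t → Critical Q t (sel t)
    crit = proj₂ G

  Selected : Fin n → Fin n → Set
  Selected j i = ∃[ t ] proj₁ (sel t) ≡ (j , i)

  edge⇒selected : ∀ {a b} → Edge {Q = Q} G a b → Selected a b ⊎ Selected b a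
  edge⇒selected (t , inj₁ e) = inj₁ (t , e)
  edge⇒selected (t , inj₂ e) = inj₂ (t , e)

  selected⇒> : ∀ {j i} → Selected j i → i < j
  selected⇒> (t , e) = subst (λ p → proj₂ p < proj₁ p) e (proj₂ (sel t))

  selector-covers : ∀ {t j i} → proj₁ (sel t) ≡ (j , i) → Covers (Q t) j i
  selector-covers {t} e = subst (λ p → Covers (Q t) (proj₁ p) (proj₂ p)) e (proj₁ (crit t))

  covers-selected⇒selects : ∀ {t j i} → Selected j i → Covers (Q t) j i →
                            proj₁ (sel t) ≡ (j , i)
  covers-selected⇒selects {t} (s , e) cov
    with critical⇒unique-coverer Q (sel s) (crit s)
           (subst (λ p → Covers (Q t) (proj₁ p) (proj₂ p)) (sym e) cov)
  ... | refl = e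

  ¬cyclic-triangle : ∀ {a b c} → Selected a b → Selected b c → Selected c a → ⊥
  ¬cyclic-triangle ab bc ca =
    <-irrefl refl (<-trans (selected⇒> ab) (<-trans (selected⇒> ca) (selected⇒> bc)))

  ¬transitive-triangle : ∀ {x y z} → Selected y x → Selected z y → Selected z x → ⊥
  ¬transitive-triangle {x} {y} {z} yx zy (t , zx) =
    <-irrefl refl (<-trans z<x (<-trans x<y y<z))
    where
    π = Q t
    x≢y : x ≢ y
    x≢y = <⇒≢ (selected⇒> yx)
    y≢z : y ≢ z
    y≢z = <⇒≢ (selected⇒> zy)
    z<x : π ⟨$⟩ˡ z < π ⟨$⟩ˡ x
    z<x = covers⇒< π (selector-covers zx)
    x<y : π ⟨$⟩ˡ x < π ⟨$⟩ˡ y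
    x<y = ¬covers⇒> π (λ y≡x → x≢y (sym y≡x))
            (λ cov → y≢z (cong proj₁ (trans (sym (covers-selected⇒selects yx cov)) zx)))
    y<z : π ⟨$⟩ˡ y < π ⟨$⟩ˡ z
    y<z = ¬covers⇒> π (λ z≡y → y≢z (sym z≡y))
            (λ cov → x≢y (cong proj₂ (trans (sym zx) (covers-selected⇒selects zy cov))))

lemma3 : (n : ℕ) → n ≥ 2 → (m : ℕ) → (Q : Fin m → Permutation′ n)
         → NoRepeats Q → MinimallyInversionComplete Q
         → (G : CriticalSelection Q) → TriangleFree (Edge {Q = Q} G)
lemma3 n _ m Q _ _ G a b c _ _ _ (eab , ebc , eac) =
  triangle (edge⇒selected eab) (edge⇒selected ebc) (edge⇒selected eac)
  where
  open SelectionGraph {Q = Q} G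
  triangle : Selected a b ⊎ Selected b a → Selected b c ⊎ Selected c b →
             Selected a c ⊎ Selected c a → ⊥
  triangle (inj₁ ab) (inj₁ bc) (inj₁ ac) = ¬transitive-triangle bc ab ac
  triangle (inj₁ ab) (inj₁ bc) (inj₂ ca) = ¬cyclic-triangle ab bc ca
  triangle (inj₁ ab) (inj₂ cb) (inj₁ ac) = ¬transitive-triangle cb ac ab
  triangle (inj₁ ab) (inj₂ cb) (inj₂ ca) = ¬transitive-triangle ab ca cb
  triangle (inj₂ ba) (inj₁ bc) (inj₁ ac) = ¬transitive-triangle ac ba bc
  triangle (inj₂ ba) (inj₁ bc) (inj₂ ca) = ¬transitive-triangle ca bc ba
  triangle (inj₂ ba) (inj₂ cb) (inj₁ ac) = ¬cyclic-triangle cb ba ac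
  triangle (inj₂ ba) (inj₂ cb) (inj₂ ca) = ¬transitive-triangle ba cb ca
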